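{- The language $\mathcal{L}$ interpreted over causal simulation models is not compact: there is a set $\Omega\subseteq\mathcal{L}$ such that every finite subset of $\Omega$ is satisfied by some causal simulation model, but no causal simulation model satisfies every formula of $\Omega$.
   Context: Fix propositional atoms $X_1,X_2,\dots$. $\mathcal{L}_{\mathrm{prop}}$ is the set of propositional formulas over them. $\mathcal{L}_{\mathrm{int}}\subset\mathcal{L}_{\mathrm{prop}}$ consists of $\top$ and all formulas $l_{i_1}\land\dots\land l_{i_n}$ with $i_1<\dots<i_n$, each $l_{i_j}$ being $X_{i_j}$ or $\lnot X_{i_j}$. $\mathcal{L}_{\mathrm{cond}}$ is the set of $[\alpha]\beta$ with $\alpha\in\mathcal{L}_{\mathrm{int}}$, $\beta\in\mathcal{L}_{\mathrm{prop}}$; $\mathcal{L}$ is the set of propositional formulas over atoms $\{X_i\}\cup\mathcal{L}_{\mathrm{cond}}$; $\langle\alpha\rangle\beta$ abbreviates $\lnot[\alpha]\lnot\beta$. A causal simulation model is a pair $(\mathsf{T},\mathbf{x})$ where $\mathsf{T}$ is a (possibly non-deterministic) Turing machine whose tape consists of binary variables $X_1,X_2,\dots$, and $\mathbf{x}$ assigns a value in $\{0,1\}$ to each, only finitely many nonzero. The intervention $\mathcal{I}_\alpha(\mathsf{T})$ first sets each variable occurring in $\alpha$ to the value dictated by its literal and then runs $\mathsf{T}$ ignoring all writes to those variables. $(\mathsf{T},\mathbf{x})\models X_i$ iff $x_i=1$; $(\mathsf{T},\mathbf{x})\models[\alpha]\beta$ iff every halting execution of $\mathcal{I}_\alpha(\mathsf{T})$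 on $\mathbf{x}$ yields a tape satisfying $\beta$; Boolean connectives as usual. -}

module Defs where

open import Data.Nat using (ℕ; zero; suc; _≤_; _<_; _≡ᵇ_)
open import Data.Bool using (Bool; true; false; not; _∧_; _∨_; if_then_else_)
open import Data.Fin using (Fin)
open import Data.List using (List; []; _∷_)
open import Data.List.Membership.Propositional using (_∈_)
open import Data.List.Relation.Unary.Linked using (Linked)
open import Data.Maybe using (Maybe; just; nothing)
open import Data.Product using (Σ; _×_; _,_; proj₁; ∃)
open import Data.Unit using (⊤)
open import Relation.Binary.PropositionalEquality using (_≡_)
open import Relation.Nullary using (¬_)
open import Relation.Binary.Construct.Closure.ReflexiveTransitive using (Star)

-- Tapes: position i holds the binary variable X_i (0-indexed naming).

Tape : Set
Tape = ℕ → Bool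

data Move : Set where
  left right stay : Move

record TM : Set where
  field
    nStates : ℕ
    start   : Fin nStates
    halting : Fin nStates → Bool
    δ       : Fin nStates → Bool → List (Fin nStates × Bool × Move)

move : Move → ℕ → ℕ
move left zero    = zero
move left (suc h) = h
move right h      = suc h
move stay h       = h

data PropF : Set where
  pvar : ℕ → PropF
  p⊤ p⊥ : PropF
  p¬ : PropF → PropF
  _p∧_ _p∨_ _p⇒_ : PropF → PropF → PropF

evalP : Tape → PropF → Bool
evalP t (pvar i)  = t i
evalP t p⊤        = true
evalP t p⊥        = false
evalP t (p¬ a)    = not (evalP t a)
evalP t (a p∧ b)  = evalP t a ∧ evalP t b
evalP t (a p∨ b)  = evalP t a ∨ evalP t b
evalP t (a p⇒ b)  = not (evalP t a) ∨ evalP t b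

-- Intervention formulas (L_int): a conjunction of literals with strictly
-- increasing indices; the empty list is ⊤.  (i , b) is X_i if b = true,
-- ¬X_i if b = false.

record IntF : Set where
  field
    lits       : List (ℕ × Bool)
    increasing : Linked (λ a b → proj₁ a < proj₁ b) lits

fixedVal : List (ℕ × Bool) → ℕ → Maybe Bool
fixedVal []             i = nothing
fixedVal ((j , b) ∷ ls) i = if j ≡ᵇ i then just b else fixedVal ls i

update : Tape → ℕ → Bool → Tape
update t h b i = if i ≡ᵇ h then b else t i

initTape : List (ℕ × Bool) → Tape → Tape
initTape ls x i with fixedVal ls i
... | just b  = b
... | nothing = x i

writeI : List (ℕ × Bool) → Tape → ℕ → Bool → Tape
writeI ls t h b with fixedVal ls h
... | just _  = t
... | nothing = update t h b

Config : TM → Set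
Config M = Fin (TM.nStates M) × ℕ × Tape

data Step (M : TM) (ls : List (ℕ × Bool)) : Config M → Config M → Set where
  step : ∀ {q h t q' b m} →
         TM.halting M q ≡ false →
         (q' , b , m) ∈ TM.δ M q (t h) →
         Step M ls (q , h , t) (q' , move m h , writeI ls t h b)

HaltingRun : (M : TM) → List (ℕ × Bool) → Tape → Tape → Set
HaltingRun M ls x t' =
  Σ (Fin (TM.nStates M)) λ q → Σ ℕ λ h →
    (TM.halting M q ≡ true) ×
    Star (Step M ls) (TM.start M , 0 , initTape ls x) (q , h , t')

record Model : Set where
  field
    machine : TM
    tape    : Tape
    finSupp : ∃ λ N → ∀ i → N ≤ i → tape i ≡ false

data Form : Set where
  var  : ℕ → Form
  box  : IntF → PropF → Form
  ⊤'   : Form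
  ¬'_  : Form → Form
  _∧'_ : Form → Form → Form

_∨'_ : Form → Form → Form
φ ∨' ψ = ¬' ((¬' φ) ∧' (¬' ψ))

_⇒'_ : Form → Form → Form
φ ⇒' ψ = ¬' (φ ∧' (¬' ψ))

dia : IntF → PropF → Form
dia α β = ¬' box α (p¬ β)

_⊨_ : Model → Form → Set
M ⊨ var i   = Model.tape M i ≡ true
M ⊨ box α β = ∀ t' → HaltingRun (Model.machine M) (IntF.lits α) (Model.tape M) t' →
              evalP t' β ≡ true
M ⊨ ⊤'      = ⊤
M ⊨ (¬' φ)  = ¬ (M ⊨ φ)
M ⊨ (φ ∧' ψ) = (M ⊨ φ) × (M ⊨ ψ)

{-# OPTIONS --safe #-}
module Submission where

open import Defs
open import Data.Bool using (true)
open import Data.Fin using (Fin)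
open import Data.List using (List; []; _∷_)
open import Data.List.Relation.Unary.All as All using (All; []; _∷_)
open import Data.Nat using (ℕ; suc; _≤_; _<_; _<?_; _⊔_)
open import Data.Nat.Properties using (≤-refl; ≤⇒≯; <-≤-trans; m≤m⊔n; m≤n⊔m)
open import Data.Product using (Σ; ∃; _×_; _,_)
open import Relation.Binary.PropositionalEquality using (_≡_; refl; sym; trans)
open import Relation.Nullary using (¬_; does)
open import Relation.Nullary.Decidable using (dec-true; dec-false)

-- Finite support is what defeats compactness: the atoms X_i are finitely
-- satisfiable by making a long enough initial segment of the tape true, but
-- no finitely supported tape makes all of them true.

IsAtom : Form → Set
IsAtom φ = ∃ λ i → φ ≡ var i

AtomBelow : ℕ → Form → Set
AtomBelow N φ = ∃ λ i → i < N × φ ≡ var i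

atomBelow-mono : ∀ {M N φ} → M ≤ N → AtomBelow M φ → AtomBelow N φ
atomBelow-mono M≤N (i , i<M , φ≡i) = i , <-≤-trans i<M M≤N , φ≡i

atoms-bounded : ∀ {Δ} → All IsAtom Δ → ∃ λ N → All (AtomBelow N) Δ
atoms-bounded [] = 0 , []
atoms-bounded ((i , φ≡i) ∷ atoms) with atoms-bounded atoms
... | N , below =
  suc i ⊔ N
  , (i , m≤m⊔n (suc i) N , φ≡i)
  ∷ All.map (atomBelow-mono (m≤n⊔m (suc i) N)) below

haltingTM : TM
haltingTM = record
  { nStates = 1
  ; start   = Fin.zero
  ; halting = λ _ → true
  ; δ       = λ _ _ → []
  }

prefixModel : ℕ → Model
prefixModel N = record
  { machine = haltingTM
  ; tape    = λ i → does (i <? N)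
  ; finSupp = N , λ i N≤i → dec-false (i <? N) (≤⇒≯ N≤i)
  }

prefixModel-⊨-atomBelow : ∀ {N φ} → AtomBelow N φ → prefixModel N ⊨ φ
prefixModel-⊨-atomBelow {N} (i , i<N , refl) = dec-true (i <? N) i<N

¬⊨-all-vars : (M : Model) → ¬ (∀ i → M ⊨ var i)
¬⊨-all-vars M ⊨var with Model.finSupp M
... | N , vanish with trans (sym (⊨var N)) (vanish N ≤-refl)
... | ()

proposition2 : Σ (Form → Set) λ Ω →
    ((Δ : List Form) → All Ω Δ → Σ Model λ M → All (M ⊨_) Δ)
    × ¬ (Σ Model λ M → ∀ φ → Ω φ → M ⊨ φ)
proposition2 = IsAtom , finitelySatisfiable , unsatisfiable
  where
  finitelySatisfiable : (Δ : List Form) → All IsAtom Δ → Σ Model λ M → All (M ⊨_) Δ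
  finitelySatisfiable Δ atoms with atoms-bounded atoms
  ... | N , below = prefixModel N , All.map prefixModel-⊨-atomBelow below

  unsatisfiable : ¬ (Σ Model λ M → ∀ φ → IsAtom φ → M ⊨ φ)
  unsatisfiable (M , ⊨atoms) = ¬⊨-all-vars M λ i → ⊨atoms (var i) (i , refl)
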